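{- Let $n>3$ and consider the directed circulant graph $C_n^+(1,3)$. For any primitive pseudo orbit of length $l$ with $0<l\le n$ that has exactly $N>0$ self-intersections, each a 2-encounter of length zero, and no other self-intersection, \[ N\le \frac{3l-2n}{4}\le \frac{l}{4}\le\frac{n}{4}. \]
   Context: $C_n^+(1,3)$ is the directed graph with vertex set $\{0,1,\dots,n-1\}$ (identified with $\mathbb{Z}/n\mathbb{Z}$) whose bonds are $(v,v+1 \bmod n)$ and $(v,v+3\bmod n)$ for every vertex $v$; the paper assumes throughout $n>a_1+d$ for $C_n^+(a_1,a_1+d)$, here $n>3$. A circuit of length $l\ge1$ is a sequence of vertices $v_0,\dots,v_l$ with $v_l=v_0$ and each $(v_i,v_{i+1})$ a bond. A periodic orbit is an equivalence class of circuits under cyclic rotation; its length is the length of any circuit in it; it is primitive if it is not a shorter periodic orbit repeated several times. A pseudo orbit is a finite collection of periodic orbits; its length is the sum of the lengths; it is primitive if it consists of primitive periodic orbits, none repeated. A periodic orbit with circuit $v_0,\dots,v_k=v_0$ traverses the vertices $v_0,\dots,v_{k-1}$ and the bonds $(v_i,v_{i+1})$ (with multiplicity); traversals of a pseudo orbit are those of all its periodic orbits together. A self-intersection ($\ell$-encounter) is a maximal sequence of consecutive vertices $v_0,\dots,v_h$ (with the bonds between them) traversed $\ell\ge2$ times in the pseudo orbit; its length is $h$. A 2-encounter of length zero is a single vertex traversed exactly twice with distinct incoming and distinct outgoing bonds at the two traversals. -}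

module Defs where

open import Data.Nat using (ℕ; zero; suc; _+_; _*_; _≤_; _<_; NonZero; _≤?_)
open import Data.Nat.Divisibility using (_∣_)
open import Data.Nat.DivMod using (_mod_)
open import Data.Fin using (Fin; toℕ; _≟_)
open import Data.List using (List; []; _∷_; map; concat; filter; length; allFin)
open import Data.Nat.ListAction using (sum)
open import Data.List.Relation.Unary.All using (All)
open import Data.List.Relation.Unary.AllPairs using (AllPairs)
open import Data.Product using (Σ; ∃; _×_; _,_)
open import Data.Sum using (_⊎_)
open import Relation.Binary.PropositionalEquality using (_≡_; _≢_)
open import Relation.Nullary using (¬_)

Bond : (n : ℕ) .{{_ : NonZero n}} → Fin n → Fin n → Set
Bond n u w = (w ≡ (toℕ u + 1) mod n) ⊎ (w ≡ (toℕ u + 3) mod n)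

-- A circuit v_0, ..., v_{len-1}, v_len = v_0 of length len = suc k ≥ 1,
-- given by its vertices v_0..v_{len-1}; each (v_i, v_{i+1 mod len}) is a bond.
record Circuit (n : ℕ) .{{_ : NonZero n}} : Set where
  field
    k     : ℕ
    vert  : Fin (suc k) → Fin n
    bonds : ∀ (i : ℕ) → Bond n (vert (i mod suc k)) (vert (suc i mod suc k))

open Circuit public

len : ∀ {n} .{{_ : NonZero n}} → Circuit n → ℕ
len c = suc (k c)

vertAt : ∀ {n} .{{_ : NonZero n}} → Circuit n → ℕ → Fin n
vertAt c j = vert c (j mod suc (k c))

-- Two circuits represent the same periodic orbit iff one is a cyclic rotation
-- of the other.  A periodic orbit is represented by any circuit in its class.
SameOrbit : ∀ {n} .{{_ : NonZero n}} → Circuit n → Circuit n → Set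
SameOrbit c c' = (len c ≡ len c') × ∃ λ r → ∀ (j : ℕ) → vertAt c' j ≡ vertAt c (j + r)

-- A periodic orbit is primitive iff it is not a shorter periodic orbit
-- repeated several times, i.e. its circuit is not the repetition (len/d times)
-- of its first d vertices for some proper divisor d of its length.
Primitive : ∀ {n} .{{_ : NonZero n}} → Circuit n → Set
Primitive c = ¬ (∃ λ d → (d ∣ len c) × (d < len c) ×
                 (∀ (j : ℕ) → vertAt c (j + d) ≡ vertAt c j))

-- A pseudo orbit: a finite collection of periodic orbits (given by representatives).
PseudoOrbit : (n : ℕ) .{{_ : NonZero n}} → Set
PseudoOrbit n = List (Circuit n)

PrimitivePO : ∀ {n} .{{_ : NonZero n}} → PseudoOrbit n → Set
PrimitivePO γ = All Primitive γ × AllPairs (λ c c' → ¬ SameOrbit c c') γ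

poLength : ∀ {n} .{{_ : NonZero n}} → PseudoOrbit n → ℕ
poLength γ = sum (map len γ)

-- A traversal of a vertex: (previous vertex, vertex, next vertex); the incoming
-- bond of the traversal is (prev, vertex) and the outgoing bond is (vertex, next).
record Traversal (n : ℕ) : Set where
  constructor trav
  field
    prev : Fin n
    here : Fin n
    next : Fin n

open Traversal public

circuitTraversals : ∀ {n} .{{_ : NonZero n}} → Circuit n → List (Traversal n)
circuitTraversals c =
  map (λ i → trav (vertAt c (toℕ i + k c)) (vertAt c (toℕ i)) (vertAt c (suc (toℕ i))))
      (allFin (len c))

poTraversals : ∀ {n} .{{_ : NonZero n}} → PseudoOrbit n → List (Traversal n)
poTraversals γ = concat (map circuitTraversals γ)

traversalsAt : ∀ {n} .{{_ : NonZero n}} → PseudoOrbit n → Fin n → List (Traversal n)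
traversalsAt γ v = filter (λ t → here t ≟ v) (poTraversals γ)

timesTraversed : ∀ {n} .{{_ : NonZero n}} → PseudoOrbit n → Fin n → ℕ
timesTraversed γ v = length (traversalsAt γ v)

-- v is a 2-encounter of length zero: traversed exactly twice, with distinct
-- incoming bonds and distinct outgoing bonds at the two traversals.
TwoEncounterLength0 : ∀ {n} .{{_ : NonZero n}} → PseudoOrbit n → Fin n → Set
TwoEncounterLength0 γ v =
  ∃ λ t → ∃ λ t' → (traversalsAt γ v ≡ t ∷ t' ∷ []) × (prev t ≢ prev t') × (next t ≢ next t')

-- "Every self-intersection of γ is a 2-encounter of length zero": every vertex
-- traversed at least twice (i.e. lying on some self-intersection) forms a
-- 2-encounter of length zero.
OnlyLength0TwoEncounters : ∀ {n} .{{_ : NonZero n}} → PseudoOrbit n → Set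
OnlyLength0TwoEncounters {n} γ = ∀ (v : Fin n) → 2 ≤ timesTraversed γ v → TwoEncounterLength0 γ v

-- number of self-intersections: under the hypothesis above these are exactly the
-- vertices traversed at least twice.
numSelfIntersections : ∀ {n} .{{_ : NonZero n}} → PseudoOrbit n → ℕ
numSelfIntersections {n} γ = length (filter (λ v → 2 ≤? timesTraversed γ v) (allFin n))

{-# OPTIONS --safe #-}
-- Read each step of γ (a bond v → v+1 or v → v+3) as an arc of length 1 or 3 on the cycle ℤ/nℤ.
-- The incoming bonds of all traversals are a permutation of the outgoing ones, so every point of
-- the cycle is covered by the same number C of arcs, and n·C = Σ arc lengths = 3l − 2a, where a
-- counts the (+1)-steps.  At a length-zero 2-encounter v the two outgoing bonds differ, so one is
-- +1 and one is +3; likewise one incoming bond is +1; and v is covered at least twice.  Hence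
-- C ≥ 2 and a ≥ 1, and l ≤ n forces C = 2.  Then b and b+1 cannot both be encounters (b+1 would
-- be covered by its own two arcs and by the +3 arc from b), so no (+1)-step joins two encounters
-- and the +1 exits and +1 entries of the N encounters are 2N distinct (+1)-steps: 2N ≤ a, which
-- is 4N + 2n ≤ 3l.
module Submission where

open import Defs
open import Data.Bool.Base using (if_then_else_)
open import Data.Empty using (⊥; ⊥-elim)
open import Data.Fin.Base using (Fin; toℕ; zero; suc)
open import Data.Fin.Properties using (_≟_; toℕ-injective; toℕ-fromℕ<; fromℕ<-cong; toℕ<n)
open import Data.List.Base
  using (List; []; _∷_; _++_; _∷ʳ_; map; filter; length; allFin; tabulate; applyUpTo)
open import Data.List.Properties
  using (map-++; map-∘; map-tabulate; length-++; length-map; length-tabulate;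
         applyUpTo-∷ʳ; map-applyUpTo)
open import Data.List.Relation.Binary.Permutation.Propositional
  using (_↭_; ↭-refl; module PermutationReasoning)
import Data.List.Relation.Binary.Permutation.Propositional.Properties as ↭
open import Data.List.Relation.Unary.All using (All; []; _∷_; universal)
import Data.List.Relation.Unary.All.Properties as All
open import Data.Nat.Base using (ℕ; zero; suc; _+_; _*_; _∸_; _≤_; _<_; _%_; z≤n; s≤s; NonZero)
open import Data.Nat.DivMod
  using (_mod_; m%n<n; m%n%n≡m%n; %-distribˡ-+; [m+n]%n≡m%n; [m+kn]%n≡m%n; m<n⇒m%n≡m)
open import Data.Nat.ListAction using (sum)
open import Data.Nat.ListAction.Properties using (sum-↭)
open import Data.Nat.Properties
  using (_≤?_; module ≤-Reasoning; +-commutativeSemigroup; +-assoc; +-comm; +-suc; +-identityʳ;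
         +-cancelʳ-≡; *-comm; *-identityˡ; *-identityʳ; *-zeroʳ; *-distribˡ-+; *-distribʳ-+;
         ≤-reflexive; ≤-trans; ≤-antisym; <⇒≤; ≮⇒≥; <-irrefl; 1+n≰n; m≤m+n; m<m+n; m≤m*n;
         m+[n∸m]≡n; +-mono-≤; +-monoˡ-≤; +-monoʳ-≤; *-monoʳ-≤)
open import Data.Nat.Tactic.RingSolver using (solve-∀)
open import Algebra.Properties.CommutativeSemigroup +-commutativeSemigroup
  using () renaming (interchange to +-interchange)
open import Data.Product.Base using (∃-syntax; _×_; _,_; proj₁; proj₂; uncurry)
open import Data.Sum.Base using (inj₁; inj₂)
open import Function.Base using (_∘_; id)
open import Function.Bundles using (_⇔_; mk⇔)
open import Relation.Binary.PropositionalEquality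
open import Relation.Nullary using (Dec; yes; no; does; ¬?)
open import Relation.Nullary.Decidable using (does-⇔)
open import Relation.Unary using (Decidable)

𝟙[_] : ∀ {p} {P : Set p} → Dec P → ℕ
𝟙[ d ] = if does d then 1 else 0

𝟙≤1 : ∀ {p} {P : Set p} (p? : Dec P) → 𝟙[ p? ] ≤ 1
𝟙≤1 (yes _) = s≤s z≤n
𝟙≤1 (no _)  = z≤n

*-𝟙≤ : ∀ {p} {P : Set p} m (p? : Dec P) → m * 𝟙[ p? ] ≤ m
*-𝟙≤ m (yes _) = ≤-reflexive (*-identityʳ m)
*-𝟙≤ m (no _)  = subst (_≤ m) (sym (*-zeroʳ m)) z≤n

𝟙-⇔ : ∀ {p q} {P : Set p} {Q : Set q} (p? : Dec P) (q? : Dec Q) → P ⇔ Q → 𝟙[ p? ] ≡ 𝟙[ q? ]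
𝟙-⇔ p? q? P⇔Q = cong (λ b → if b then 1 else 0) (does-⇔ P⇔Q p? q?)

𝟙+𝟙≤1 : ∀ {p q} {P : Set p} {Q : Set q} (p? : Dec P) (q? : Dec Q) →
        (P → Q → ⊥) → 𝟙[ p? ] + 𝟙[ q? ] ≤ 1
𝟙+𝟙≤1 (yes p) (yes q) notBoth = ⊥-elim (notBoth p q)
𝟙+𝟙≤1 (yes _) (no _)  _       = s≤s z≤n
𝟙+𝟙≤1 (no _)  q?      _       = 𝟙≤1 q?

module _ {a} {A : Set a} where

  ∑ : List A → (A → ℕ) → ℕ
  ∑ xs w = sum (map w xs)

  ∑-zero : ∀ (xs : List A) → ∑ xs (λ _ → 0) ≡ 0
  ∑-zero []       = refl
  ∑-zero (_ ∷ xs) = ∑-zero xs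

  ∑-const : ∀ (xs : List A) k → ∑ xs (λ _ → k) ≡ length xs * k
  ∑-const []       k = refl
  ∑-const (_ ∷ xs) k = cong (k +_) (∑-const xs k)

  ∑-cong : ∀ {f g : A → ℕ} → f ≗ g → ∀ xs → ∑ xs f ≡ ∑ xs g
  ∑-cong f≗g []       = refl
  ∑-cong f≗g (x ∷ xs) = cong₂ _+_ (f≗g x) (∑-cong f≗g xs)

  ∑-cong-All : ∀ {ℓ} {P : A → Set ℓ} {f g : A → ℕ} {xs} →
               All P xs → (∀ {x} → P x → f x ≡ g x) → ∑ xs f ≡ ∑ xs g
  ∑-cong-All []         f≡g = refl
  ∑-cong-All (px ∷ pxs) f≡g = cong₂ _+_ (f≡g px) (∑-cong-All pxs f≡g)

  ∑-mono : ∀ {f g : A → ℕ} → (∀ x → f x ≤ g x) → ∀ xs → ∑ xs f ≤ ∑ xs g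
  ∑-mono f≤g []       = z≤n
  ∑-mono f≤g (x ∷ xs) = +-mono-≤ (f≤g x) (∑-mono f≤g xs)

  ∑-+ : ∀ xs (f g : A → ℕ) → ∑ xs (λ x → f x + g x) ≡ ∑ xs f + ∑ xs g
  ∑-+ []       f g = refl
  ∑-+ (x ∷ xs) f g =
    trans (cong (f x + g x +_) (∑-+ xs f g)) (+-interchange (f x) (g x) (∑ xs f) (∑ xs g))

  ∑-*ˡ : ∀ xs k (f : A → ℕ) → ∑ xs (λ x → k * f x) ≡ k * ∑ xs f
  ∑-*ˡ []       k f = sym (*-zeroʳ k)
  ∑-*ˡ (x ∷ xs) k f = trans (cong (k * f x +_) (∑-*ˡ xs k f)) (sym (*-distribˡ-+ k (f x) (∑ xs f)))

  ∑-*ʳ : ∀ xs (f : A → ℕ) k → ∑ xs (λ x → f x * k) ≡ ∑ xs f * k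
  ∑-*ʳ []       f k = refl
  ∑-*ʳ (x ∷ xs) f k = trans (cong (f x * k +_) (∑-*ʳ xs f k)) (sym (*-distribʳ-+ k (f x) (∑ xs f)))

  ∑-↭ : ∀ {xs ys} (w : A → ℕ) → xs ↭ ys → ∑ xs w ≡ ∑ ys w
  ∑-↭ w xs↭ys = sum-↭ (↭.map⁺ w xs↭ys)

  ∑-pair : ∀ x y (w : A → ℕ) → ∑ (x ∷ y ∷ []) w ≡ w x + w y
  ∑-pair x y w = cong (w x +_) (+-identityʳ (w y))

  module _ {ℓ} {P : A → Set ℓ} (P? : Decidable P) where

    ∑-filter : ∀ xs (w : A → ℕ) → ∑ (filter P? xs) w ≡ ∑ xs (λ x → 𝟙[ P? x ] * w x)
    ∑-filter []       w = refl
    ∑-filter (x ∷ xs) w with P? x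
    ... | yes _ = cong₂ _+_ (sym (*-identityˡ (w x))) (∑-filter xs w)
    ... | no  _ = ∑-filter xs w

    length-filter-∑ : ∀ xs → length (filter P? xs) ≡ ∑ xs (λ x → 𝟙[ P? x ])
    length-filter-∑ []       = refl
    length-filter-∑ (x ∷ xs) with P? x
    ... | yes _ = cong suc (length-filter-∑ xs)
    ... | no  _ = length-filter-∑ xs

    0<length-filter⇒∃ : ∀ xs → 0 < length (filter P? xs) → ∃[ x ] P x
    0<length-filter⇒∃ (x ∷ xs) 0<len with P? x
    ... | yes px = x , px
    ... | no  _  = 0<length-filter⇒∃ xs 0<len

∑-comm : ∀ {a b} {A : Set a} {B : Set b} xs (ys : List B) (f : A → B → ℕ) →
         ∑ xs (λ x → ∑ ys (f x)) ≡ ∑ ys (λ y → ∑ xs (λ x → f x y))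
∑-comm []       ys f = sym (∑-zero ys)
∑-comm (x ∷ xs) ys f =
  trans (cong (∑ ys (f x) +_) (∑-comm xs ys f)) (sym (∑-+ ys (f x) (λ y → ∑ xs (λ x → f x y))))

∑-map : ∀ {a b} {A : Set a} {B : Set b} (f : A → B) xs (w : B → ℕ) → ∑ (map f xs) w ≡ ∑ xs (w ∘ f)
∑-map f xs w = cong sum (sym (map-∘ xs))

∑-allFin-suc : ∀ {m} (w : Fin (suc m) → ℕ) → ∑ (allFin (suc m)) w ≡ w zero + ∑ (allFin m) (w ∘ suc)
∑-allFin-suc w = cong (λ ws → w zero + sum ws)
  (trans (map-tabulate suc w) (sym (map-tabulate id (w ∘ suc))))

∑-allFin-𝟙≟ : ∀ {m} (x : Fin m) → ∑ (allFin m) (λ u → 𝟙[ x ≟ u ]) ≡ 1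
∑-allFin-𝟙≟ {suc m} zero    = trans (∑-allFin-suc {m} (λ u → 𝟙[ zero ≟ u ])) (cong suc (∑-zero (allFin m)))
∑-allFin-𝟙≟ {suc m} (suc x) = trans (∑-allFin-suc {m} (λ u → 𝟙[ suc x ≟ u ])) (∑-allFin-𝟙≟ x)

module _ {a} {A : Set a} {n} (f : A → Fin n) where

  fiber : List A → Fin n → List A
  fiber xs u = filter (λ x → f x ≟ u) xs

  ∑-fibers : ∀ xs (w : A → ℕ) → ∑ (allFin n) (λ u → ∑ (fiber xs u) w) ≡ ∑ xs w
  ∑-fibers xs w = begin
    ∑ (allFin n) (λ u → ∑ (fiber xs u) w)
      ≡⟨ ∑-cong (λ u → ∑-filter (λ x → f x ≟ u) xs w) (allFin n) ⟩
    ∑ (allFin n) (λ u → ∑ xs (λ x → 𝟙[ f x ≟ u ] * w x))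
      ≡⟨ ∑-comm (allFin n) xs _ ⟩
    ∑ xs (λ x → ∑ (allFin n) (λ u → 𝟙[ f x ≟ u ] * w x))
      ≡⟨ ∑-cong (λ x → ∑-*ʳ (allFin n) _ (w x)) xs ⟩
    ∑ xs (λ x → ∑ (allFin n) (λ u → 𝟙[ f x ≟ u ]) * w x)
      ≡⟨ ∑-cong (λ x → trans (cong (_* w x) (∑-allFin-𝟙≟ (f x))) (*-identityˡ (w x))) xs ⟩
    ∑ xs w
      ∎
    where open ≡-Reasoning

  length-filter≤∑-fibers : ∀ {ℓ} {P : Fin n → Set ℓ} (P? : Decidable P) xs (w : A → ℕ) →
                           (∀ u → P u → 1 ≤ ∑ (fiber xs u) w) →
                           length (filter P? (allFin n)) ≤ ∑ xs (λ x → w x * 𝟙[ P? (f x) ])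
  length-filter≤∑-fibers {P = P} P? xs w heavy = begin
    length (filter P? (allFin n))
      ≡⟨ length-filter-∑ P? (allFin n) ⟩
    ∑ (allFin n) (λ u → 𝟙[ P? u ])
      ≤⟨ ∑-mono (λ u → 𝟙≤fiber u (P? u)) (allFin n) ⟩
    ∑ (allFin n) (λ u → ∑ (fiber xs u) w * 𝟙[ P? u ])
      ≡⟨ ∑-cong (λ u → ∑-*ʳ (fiber xs u) w _) (allFin n) ⟨
    ∑ (allFin n) (λ u → ∑ (fiber xs u) (λ x → w x * 𝟙[ P? u ]))
      ≡⟨ ∑-cong (λ u → ∑-cong-All (All.all-filter _ xs) (λ fx≡u → cong (λ v → w _ * 𝟙[ P? v ]) (sym fx≡u)))
                (allFin n) ⟩
    ∑ (allFin n) (λ u → ∑ (fiber xs u) (λ x → w x * 𝟙[ P? (f x) ]))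
      ≡⟨ ∑-fibers xs _ ⟩
    ∑ xs (λ x → w x * 𝟙[ P? (f x) ])
      ∎
    where
    open ≤-Reasoning
    𝟙≤fiber : ∀ u (p? : Dec (P u)) → 𝟙[ p? ] ≤ ∑ (fiber xs u) w * 𝟙[ p? ]
    𝟙≤fiber u (yes p) = ≤-trans (heavy u p) (≤-reflexive (sym (*-identityʳ _)))
    𝟙≤fiber u (no _)  = z≤n

module _ {a} {A : Set a} where

  tabulate-toℕ : ∀ {m} (f : ℕ → A) → tabulate {n = m} (f ∘ toℕ) ≡ applyUpTo f m
  tabulate-toℕ {zero}  f = refl
  tabulate-toℕ {suc m} f = cong (f 0 ∷_) (tabulate-toℕ (f ∘ suc))

  applyUpTo-cong : ∀ {f g : ℕ → A} → f ≗ g → ∀ m → applyUpTo f m ≡ applyUpTo g m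
  applyUpTo-cong f≗g zero    = refl
  applyUpTo-cong f≗g (suc m) = cong₂ _∷_ (f≗g 0) (applyUpTo-cong (f≗g ∘ suc) m)

  applyUpTo-rotate : ∀ (f : ℕ → A) k → (∀ i → f (suc i + k) ≡ f i) →
                     applyUpTo (λ i → f (i + k)) (suc k) ↭ applyUpTo f (suc k)
  applyUpTo-rotate f k periodic = begin
    f k ∷ applyUpTo (λ i → f (suc i + k)) k ≡⟨ cong (f k ∷_) (applyUpTo-cong periodic k) ⟩
    f k ∷ applyUpTo f k                     ↭⟨ ↭.∷↭∷ʳ (f k) (applyUpTo f k) ⟩
    applyUpTo f k ∷ʳ f k                    ≡⟨ applyUpTo-∷ʳ f k ⟩
    applyUpTo f (suc k)                     ∎
    where open PermutationReasoning

mod-cong : ∀ {d} .{{_ : NonZero d}} {i j} → i % d ≡ j % d → i mod d ≡ j mod d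
mod-cong {d} {i} {j} i≡j = fromℕ<-cong (i % d) (j % d) i≡j (m%n<n i d) (m%n<n j d)

module _ {n : ℕ} .{{_ : NonZero n}} where

  infixl 6 _+ₘ_

  _+ₘ_ : Fin n → ℕ → Fin n
  x +ₘ j = (toℕ x + j) mod n

  toℕ-+ₘ : ∀ x j → toℕ (x +ₘ j) ≡ (toℕ x + j) % n
  toℕ-+ₘ x j = toℕ-fromℕ< (m%n<n (toℕ x + j) n)

  +ₘ-assoc : ∀ x i j → x +ₘ i +ₘ j ≡ x +ₘ (i + j)
  +ₘ-assoc x i j = mod-cong (begin
    (toℕ (x +ₘ i) + j) % n              ≡⟨ cong (λ m → (m + j) % n) (toℕ-+ₘ x i) ⟩
    ((toℕ x + i) % n + j) % n           ≡⟨ %-distribˡ-+ ((toℕ x + i) % n) j n ⟩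
    ((toℕ x + i) % n % n + j % n) % n   ≡⟨ cong (λ m → (m + j % n) % n) (m%n%n≡m%n (toℕ x + i) n) ⟩
    ((toℕ x + i) % n + j % n) % n       ≡⟨ %-distribˡ-+ (toℕ x + i) j n ⟨
    (toℕ x + i + j) % n                 ≡⟨ cong (_% n) (+-assoc (toℕ x) i j) ⟩
    (toℕ x + (i + j)) % n               ∎)
    where open ≡-Reasoning

  +ₘ-*n : ∀ x j → x +ₘ j * n ≡ x
  +ₘ-*n x j = toℕ-injective (begin
    toℕ (x +ₘ j * n)      ≡⟨ toℕ-+ₘ x (j * n) ⟩
    (toℕ x + j * n) % n   ≡⟨ [m+kn]%n≡m%n (toℕ x) j n ⟩
    toℕ x % n             ≡⟨ m<n⇒m%n≡m (toℕ<n x) ⟩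
    toℕ x                 ∎)
    where open ≡-Reasoning

  +ₘ-identityʳ : ∀ x → x +ₘ 0 ≡ x
  +ₘ-identityʳ x = +ₘ-*n x 0

  +ₘ-cancelʳ : ∀ {x y} j → x +ₘ j ≡ y +ₘ j → x ≡ y
  +ₘ-cancelʳ {x} {y} j x+j≡y+j = trans (sym (undo x)) (trans (cong (_+ₘ (j * n ∸ j)) x+j≡y+j) (undo y))
    where
    undo : ∀ z → z +ₘ j +ₘ (j * n ∸ j) ≡ z
    undo z = trans (+ₘ-assoc z j _) (trans (cong (z +ₘ_) (m+[n∸m]≡n (m≤m*n j n))) (+ₘ-*n z j))

  +ₘ-surjective : ∀ p q → ∃[ j ] p +ₘ j ≡ q
  +ₘ-surjective p q = n ∸ toℕ p + toℕ q , toℕ-injective (begin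
    toℕ (p +ₘ (n ∸ toℕ p + toℕ q))      ≡⟨ toℕ-+ₘ p _ ⟩
    (toℕ p + (n ∸ toℕ p + toℕ q)) % n   ≡⟨ cong (_% n) (+-assoc (toℕ p) _ _) ⟨
    (toℕ p + (n ∸ toℕ p) + toℕ q) % n   ≡⟨ cong (λ m → (m + toℕ q) % n) (m+[n∸m]≡n (<⇒≤ (toℕ<n p))) ⟩
    (n + toℕ q) % n                     ≡⟨ cong (_% n) (+-comm n (toℕ q)) ⟩
    (toℕ q + n) % n                     ≡⟨ [m+n]%n≡m%n (toℕ q) n ⟩
    toℕ q % n                           ≡⟨ m<n⇒m%n≡m (toℕ<n q) ⟩
    toℕ q                               ∎)
    where open ≡-Reasoning

  𝟙-+ₘ : ∀ x y j → 𝟙[ x +ₘ j ≟ y +ₘ j ] ≡ 𝟙[ x ≟ y ]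
  𝟙-+ₘ x y j = 𝟙-⇔ (x +ₘ j ≟ y +ₘ j) (x ≟ y) (mk⇔ (+ₘ-cancelʳ j) (cong (_+ₘ j)))

  -- Steps along the bonds of C_n^+(1,3)

  bond-long : ∀ {u w} → Bond n u w → w ≢ u +ₘ 1 → w ≡ u +ₘ 3
  bond-long (inj₁ short) long = ⊥-elim (long short)
  bond-long (inj₂ long)  _    = long

  FollowsBonds : Traversal n → Set
  FollowsBonds t = Bond n (prev t) (here t) × Bond n (here t) (next t)

  isShort isLong entersShort stepLength : Traversal n → ℕ
  isShort t     = 𝟙[ next t ≟ here t +ₘ 1 ]
  isLong t      = 𝟙[ ¬? (next t ≟ here t +ₘ 1) ]
  entersShort t = 𝟙[ here t ≟ prev t +ₘ 1 ]
  stepLength t  = 1 + 2 * isLong t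

  next≡here+ₘstepLength : ∀ t → Bond n (here t) (next t) → next t ≡ here t +ₘ stepLength t
  next≡here+ₘstepLength t bond with next t ≟ here t +ₘ 1
  ... | yes short = short
  ... | no  long  = bond-long bond long

  stepLength+2*isShort : ∀ t → stepLength t + 2 * isShort t ≡ 3
  stepLength+2*isShort t with next t ≟ here t +ₘ 1
  ... | yes _ = refl
  ... | no  _ = refl

  distinctExits : ∀ {t t′} → Bond n (here t) (next t) → Bond n (here t′) (next t′) →
                  here t ≡ here t′ → next t ≢ next t′ →
                  (isShort t + isShort t′ ≡ 1) × (isLong t + isLong t′ ≡ 1)
  distinctExits {t} {t′} bond bond′ sameHere differ
    with next t ≟ here t +ₘ 1 | next t′ ≟ here t′ +ₘ 1
  ... | yes short | yes short′ = ⊥-elim (differ (trans short (trans (cong (_+ₘ 1) sameHere) (sym short′))))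
  ... | yes _     | no  _      = refl , refl
  ... | no  _     | yes _      = refl , refl
  ... | no  long  | no  long′  =
    ⊥-elim (differ (trans (bond-long bond long) (trans (cong (_+ₘ 3) sameHere) (sym (bond-long bond′ long′)))))

  distinctEntries : ∀ {t t′} → Bond n (prev t) (here t) → Bond n (prev t′) (here t′) →
                    here t ≡ here t′ → prev t ≢ prev t′ → entersShort t + entersShort t′ ≡ 1
  distinctEntries {t} {t′} bond bond′ sameHere differ
    with here t ≟ prev t +ₘ 1 | here t′ ≟ prev t′ +ₘ 1
  ... | yes short | yes short′ = ⊥-elim (differ (+ₘ-cancelʳ 1 (trans (sym short) (trans sameHere short′))))
  ... | yes _     | no  _      = refl
  ... | no  _     | yes _      = refl
  ... | no  long  | no  long′  =
    ⊥-elim (differ (+ₘ-cancelʳ 3 (trans (sym (bond-long bond long)) (trans sameHere (bond-long bond′ long′)))))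

  traversalAt : Circuit n → ℕ → Traversal n
  traversalAt c i = trav (vertAt c (i + k c)) (vertAt c i) (vertAt c (suc i))

  vertAt-periodic : ∀ c i → vertAt c (suc (i + k c)) ≡ vertAt c i
  vertAt-periodic c i = cong (vert c) (mod-cong {i = suc (i + k c)} {j = i}
    (trans (cong (_% len c) (sym (+-suc i (k c)))) ([m+n]%n≡m%n i (len c))))

  circuitTraversals≡applyUpTo : ∀ c → circuitTraversals c ≡ applyUpTo (traversalAt c) (len c)
  circuitTraversals≡applyUpTo c =
    trans (map-tabulate id (traversalAt c ∘ toℕ)) (tabulate-toℕ (traversalAt c))

  circuit-followsBonds : ∀ c → All FollowsBonds (circuitTraversals c)
  circuit-followsBonds c = All.map⁺ (universal bondsAt (allFin (len c)))
    where
    bondsAt : ∀ i → FollowsBonds (traversalAt c (toℕ i))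
    bondsAt i = subst (Bond n _) (vertAt-periodic c (toℕ i)) (bonds c (toℕ i + k c)) , bonds c (toℕ i)

  inBond outBond : Traversal n → Fin n × Fin n
  inBond t  = prev t , here t
  outBond t = here t , next t

  circuit-inBonds↭outBonds : ∀ c → map inBond (circuitTraversals c) ↭ map outBond (circuitTraversals c)
  circuit-inBonds↭outBonds c = begin
    map inBond (circuitTraversals c)                ≡⟨ cong (map inBond) (circuitTraversals≡applyUpTo c) ⟩
    map inBond (applyUpTo (traversalAt c) (len c))  ≡⟨ map-applyUpTo (traversalAt c) inBond (len c) ⟩
    applyUpTo (inBond ∘ traversalAt c) (len c)      ≡⟨ applyUpTo-cong inBond≡rotatedOutBond (len c) ⟩
    applyUpTo (λ i → F (i + k c)) (len c)           ↭⟨ applyUpTo-rotate F (k c) F-periodic ⟩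
    applyUpTo F (len c)                             ≡⟨ map-applyUpTo (traversalAt c) outBond (len c) ⟨
    map outBond (applyUpTo (traversalAt c) (len c)) ≡⟨ cong (map outBond) (circuitTraversals≡applyUpTo c) ⟨
    map outBond (circuitTraversals c)               ∎
    where
    open PermutationReasoning
    F : ℕ → Fin n × Fin n
    F = outBond ∘ traversalAt c
    inBond≡rotatedOutBond : ∀ i → inBond (traversalAt c i) ≡ F (i + k c)
    inBond≡rotatedOutBond i = cong (vertAt c (i + k c) ,_) (sym (vertAt-periodic c i))
    F-periodic : ∀ i → F (suc i + k c) ≡ F i
    F-periodic i = cong₂ _,_ (vertAt-periodic c i) (vertAt-periodic c (suc i))

  length-circuitTraversals : ∀ c → length (circuitTraversals c) ≡ len c
  length-circuitTraversals c = trans (length-map _ (allFin (len c))) (length-tabulate id)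

  poTraversals-followBonds : ∀ γ → All FollowsBonds (poTraversals γ)
  poTraversals-followBonds []      = []
  poTraversals-followBonds (c ∷ γ) = All.++⁺ (circuit-followsBonds c) (poTraversals-followBonds γ)

  inBonds↭outBonds : ∀ γ → map inBond (poTraversals γ) ↭ map outBond (poTraversals γ)
  inBonds↭outBonds []      = ↭-refl
  inBonds↭outBonds (c ∷ γ) = begin
    map inBond (circuitTraversals c ++ poTraversals γ)
      ≡⟨ map-++ inBond (circuitTraversals c) _ ⟩
    map inBond (circuitTraversals c) ++ map inBond (poTraversals γ)
      ↭⟨ ↭.++⁺ (circuit-inBonds↭outBonds c) (inBonds↭outBonds γ) ⟩
    map outBond (circuitTraversals c) ++ map outBond (poTraversals γ)
      ≡⟨ map-++ outBond (circuitTraversals c) _ ⟨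
    map outBond (circuitTraversals c ++ poTraversals γ)
      ∎
    where open PermutationReasoning

  ∑-inBond≡∑-outBond : ∀ γ (g : Fin n → Fin n → ℕ) →
                       ∑ (poTraversals γ) (λ t → g (prev t) (here t)) ≡
                       ∑ (poTraversals γ) (λ t → g (here t) (next t))
  ∑-inBond≡∑-outBond γ g = begin
    ∑ (poTraversals γ) (uncurry g ∘ inBond)      ≡⟨ ∑-map inBond (poTraversals γ) (uncurry g) ⟨
    ∑ (map inBond (poTraversals γ)) (uncurry g)  ≡⟨ ∑-↭ (uncurry g) (inBonds↭outBonds γ) ⟩
    ∑ (map outBond (poTraversals γ)) (uncurry g) ≡⟨ ∑-map outBond (poTraversals γ) (uncurry g) ⟩
    ∑ (poTraversals γ) (uncurry g ∘ outBond)     ∎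
    where open ≡-Reasoning

  length-poTraversals : ∀ γ → length (poTraversals γ) ≡ poLength γ
  length-poTraversals []      = refl
  length-poTraversals (c ∷ γ) =
    trans (length-++ (circuitTraversals c)) (cong₂ _+_ (length-circuitTraversals c) (length-poTraversals γ))

  -- The winding number of a pseudo orbit

  coverage : Fin n → ℕ → Fin n → ℕ
  coverage h zero    p = 0
  coverage h (suc L) p = 𝟙[ h ≟ p ] + coverage (h +ₘ 1) L p

  ∑-coverage : ∀ h L → ∑ (allFin n) (coverage h L) ≡ L
  ∑-coverage h zero    = ∑-zero (allFin n)
  ∑-coverage h (suc L) =
    trans (∑-+ (allFin n) _ _) (cong₂ _+_ (∑-allFin-𝟙≟ h) (∑-coverage (h +ₘ 1) L))

  coverage-+ₘ1 : ∀ h L p → coverage h L (p +ₘ 1) + 𝟙[ h +ₘ L ≟ p +ₘ 1 ] ≡ coverage h L p + 𝟙[ h ≟ p +ₘ 1 ]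
  coverage-+ₘ1 h zero    p = cong (λ x → 𝟙[ x ≟ p +ₘ 1 ]) (+ₘ-identityʳ h)
  coverage-+ₘ1 h (suc L) p = begin
    𝟙[ h ≟ p +ₘ 1 ] + coverage (h +ₘ 1) L (p +ₘ 1) + 𝟙[ h +ₘ suc L ≟ p +ₘ 1 ]
      ≡⟨ cong (λ x → 𝟙[ h ≟ p +ₘ 1 ] + coverage (h +ₘ 1) L (p +ₘ 1) + 𝟙[ x ≟ p +ₘ 1 ]) (+ₘ-assoc h 1 L) ⟨
    𝟙[ h ≟ p +ₘ 1 ] + coverage (h +ₘ 1) L (p +ₘ 1) + 𝟙[ h +ₘ 1 +ₘ L ≟ p +ₘ 1 ]
      ≡⟨ +-assoc 𝟙[ h ≟ p +ₘ 1 ] _ _ ⟩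
    𝟙[ h ≟ p +ₘ 1 ] + (coverage (h +ₘ 1) L (p +ₘ 1) + 𝟙[ h +ₘ 1 +ₘ L ≟ p +ₘ 1 ])
      ≡⟨ cong (𝟙[ h ≟ p +ₘ 1 ] +_) (coverage-+ₘ1 (h +ₘ 1) L p) ⟩
    𝟙[ h ≟ p +ₘ 1 ] + (coverage (h +ₘ 1) L p + 𝟙[ h +ₘ 1 ≟ p +ₘ 1 ])
      ≡⟨ cong (λ x → 𝟙[ h ≟ p +ₘ 1 ] + (coverage (h +ₘ 1) L p + x)) (𝟙-+ₘ h p 1) ⟩
    𝟙[ h ≟ p +ₘ 1 ] + (coverage (h +ₘ 1) L p + 𝟙[ h ≟ p ])
      ≡⟨ +-comm 𝟙[ h ≟ p +ₘ 1 ] _ ⟩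
    coverage (h +ₘ 1) L p + 𝟙[ h ≟ p ] + 𝟙[ h ≟ p +ₘ 1 ]
      ≡⟨ cong (_+ 𝟙[ h ≟ p +ₘ 1 ]) (+-comm (coverage (h +ₘ 1) L p) _) ⟩
    𝟙[ h ≟ p ] + coverage (h +ₘ 1) L p + 𝟙[ h ≟ p +ₘ 1 ]
      ∎
    where open ≡-Reasoning

  module _ (γ : PseudoOrbit n) where

    winding : Fin n → ℕ
    winding p = ∑ (poTraversals γ) (λ t → coverage (here t) (stepLength t) p)

    winding-+ₘ1 : ∀ p → winding (p +ₘ 1) ≡ winding p
    winding-+ₘ1 p = +-cancelʳ-≡ (arrivals (p +ₘ 1)) _ _ (begin
      winding (p +ₘ 1) + arrivals (p +ₘ 1)
        ≡⟨ cong (winding (p +ₘ 1) +_) (∑-inBond≡∑-outBond γ (λ _ y → 𝟙[ y ≟ p +ₘ 1 ])) ⟩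
      winding (p +ₘ 1) + ∑ T (λ t → 𝟙[ next t ≟ p +ₘ 1 ])
        ≡⟨ ∑-+ T _ _ ⟨
      ∑ T (λ t → coverage (here t) (stepLength t) (p +ₘ 1) + 𝟙[ next t ≟ p +ₘ 1 ])
        ≡⟨ ∑-cong-All (poTraversals-followBonds γ) shift ⟩
      ∑ T (λ t → coverage (here t) (stepLength t) p + 𝟙[ here t ≟ p +ₘ 1 ])
        ≡⟨ ∑-+ T _ _ ⟩
      winding p + arrivals (p +ₘ 1)
        ∎)
      where
      open ≡-Reasoning
      T : List (Traversal n)
      T = poTraversals γ
      arrivals : Fin n → ℕ
      arrivals q = ∑ T (λ t → 𝟙[ here t ≟ q ])
      shift : ∀ {t} → FollowsBonds t →
              coverage (here t) (stepLength t) (p +ₘ 1) + 𝟙[ next t ≟ p +ₘ 1 ] ≡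
              coverage (here t) (stepLength t) p + 𝟙[ here t ≟ p +ₘ 1 ]
      shift {t} (_ , out) = trans
        (cong (λ x → coverage (here t) (stepLength t) (p +ₘ 1) + 𝟙[ x ≟ p +ₘ 1 ]) (next≡here+ₘstepLength t out))
        (coverage-+ₘ1 (here t) (stepLength t) p)

    winding-+ₘ : ∀ p j → winding (p +ₘ j) ≡ winding p
    winding-+ₘ p zero    = cong winding (+ₘ-identityʳ p)
    winding-+ₘ p (suc j) =
      trans (cong winding (sym (+ₘ-assoc p 1 j))) (trans (winding-+ₘ (p +ₘ 1) j) (winding-+ₘ1 p))

    winding-constant : ∀ p q → winding p ≡ winding q
    winding-constant p q with +ₘ-surjective p q
    ... | j , refl = sym (winding-+ₘ p j)

    n*winding : ∀ p → n * winding p ≡ ∑ (poTraversals γ) stepLength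
    n*winding p = begin
      n * winding p                       ≡⟨ cong (_* winding p) (length-tabulate {n = n} id) ⟨
      length (allFin n) * winding p       ≡⟨ ∑-const (allFin n) (winding p) ⟨
      ∑ (allFin n) (λ _ → winding p)      ≡⟨ ∑-cong (winding-constant p) (allFin n) ⟩
      ∑ (allFin n) winding                ≡⟨ ∑-comm (poTraversals γ) (allFin n) _ ⟨
      ∑ (poTraversals γ) (λ t → ∑ (allFin n) (coverage (here t) (stepLength t)))
                                          ≡⟨ ∑-cong (λ t → ∑-coverage (here t) (stepLength t)) (poTraversals γ) ⟩
      ∑ (poTraversals γ) stepLength       ∎
      where open ≡-Reasoning

    winding-equation : ∀ p → n * winding p + 2 * ∑ (poTraversals γ) isShort ≡ 3 * poLength γ
    winding-equation p = begin
      n * winding p + 2 * ∑ T isShort              ≡⟨ cong₂ _+_ (n*winding p) (sym (∑-*ˡ T 2 isShort)) ⟩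
      ∑ T stepLength + ∑ T (λ t → 2 * isShort t)   ≡⟨ ∑-+ T stepLength _ ⟨
      ∑ T (λ t → stepLength t + 2 * isShort t)     ≡⟨ ∑-cong stepLength+2*isShort T ⟩
      ∑ T (λ _ → 3)                                ≡⟨ ∑-const T 3 ⟩
      length T * 3                                 ≡⟨ cong (_* 3) (length-poTraversals γ) ⟩
      poLength γ * 3                               ≡⟨ *-comm (poLength γ) 3 ⟩
      3 * poLength γ                               ∎
      where
      open ≡-Reasoning
      T : List (Traversal n)
      T = poTraversals γ

    timesTraversed≤winding : ∀ v → timesTraversed γ v ≤ winding v
    timesTraversed≤winding v = begin
      timesTraversed γ v                         ≡⟨ length-filter-∑ (λ t → here t ≟ v) (poTraversals γ) ⟩
      ∑ (poTraversals γ) (λ t → 𝟙[ here t ≟ v ]) ≤⟨ ∑-mono (λ t → m≤m+n _ _) (poTraversals γ) ⟩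
      winding v                                  ∎
      where open ≤-Reasoning

    timesTraversed+longExits≤winding : ∀ b →
      timesTraversed γ (b +ₘ 1) + ∑ (traversalsAt γ b) isLong ≤ winding (b +ₘ 1)
    timesTraversed+longExits≤winding b = begin
      timesTraversed γ (b +ₘ 1) + ∑ (traversalsAt γ b) isLong
        ≡⟨ cong₂ _+_ (length-filter-∑ (λ t → here t ≟ b +ₘ 1) T) (∑-filter (λ t → here t ≟ b) T isLong) ⟩
      ∑ T (λ t → 𝟙[ here t ≟ b +ₘ 1 ]) + ∑ T (λ t → 𝟙[ here t ≟ b ] * isLong t)
        ≡⟨ ∑-+ T _ _ ⟨
      ∑ T (λ t → 𝟙[ here t ≟ b +ₘ 1 ] + 𝟙[ here t ≟ b ] * isLong t)
        ≤⟨ ∑-mono passesOver T ⟩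
      winding (b +ₘ 1)
        ∎
      where
      open ≤-Reasoning
      T : List (Traversal n)
      T = poTraversals γ
      passesOver : ∀ t → 𝟙[ here t ≟ b +ₘ 1 ] + 𝟙[ here t ≟ b ] * isLong t ≤
                         coverage (here t) (stepLength t) (b +ₘ 1)
      passesOver t with next t ≟ here t +ₘ 1
      ... | yes _ = +-monoʳ-≤ _ (≤-reflexive (*-zeroʳ 𝟙[ here t ≟ b ]))
      ... | no  _ = +-monoʳ-≤ _ (≤-trans (≤-reflexive (trans (*-identityʳ 𝟙[ here t ≟ b ]) (sym (𝟙-+ₘ (here t) b 1))))
                                         (m≤m+n _ _))

    -- Length-zero 2-encounters

    record EncounterSteps (ts : List (Traversal n)) : Set where
      field
        oneShortExit  : ∑ ts isShort ≡ 1
        oneLongExit   : ∑ ts isLong ≡ 1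
        oneShortEntry : ∑ ts entersShort ≡ 1

    twoEncounter-steps : ∀ {v} → TwoEncounterLength0 γ v → EncounterSteps (traversalsAt γ v)
    twoEncounter-steps {v} (t , t′ , split , prevs , nexts)
      with subst (All (λ s → here s ≡ v)) split (All.all-filter (λ s → here s ≟ v) (poTraversals γ))
         | subst (All FollowsBonds) split (All.filter⁺ (λ s → here s ≟ v) (poTraversals-followBonds γ))
    ... | atV ∷ atV′ ∷ [] | (enter , exit) ∷ (enter′ , exit′) ∷ [] = record
      { oneShortExit  = count isShort (proj₁ exits)
      ; oneLongExit   = count isLong (proj₂ exits)
      ; oneShortEntry = count entersShort entries
      }
      where
      sameHere : here t ≡ here t′
      sameHere = trans atV (sym atV′)
      exits : (isShort t + isShort t′ ≡ 1) × (isLong t + isLong t′ ≡ 1)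
      exits = distinctExits {t} {t′} exit exit′ sameHere nexts
      entries : entersShort t + entersShort t′ ≡ 1
      entries = distinctEntries {t} {t′} enter enter′ sameHere prevs
      count : ∀ w → w t + w t′ ≡ 1 → ∑ (traversalsAt γ v) w ≡ 1
      count w sum≡1 = trans (cong (λ ts → ∑ ts w) split) (trans (∑-pair t t′ w) sum≡1)

    module _ (only : OnlyLength0TwoEncounters γ) where

      selfIntersection : Fin n → ℕ
      selfIntersection v = 𝟙[ 2 ≤? timesTraversed γ v ]

      N≤shortExits : numSelfIntersections γ ≤ ∑ (poTraversals γ) (λ t → isShort t * selfIntersection (here t))
      N≤shortExits = length-filter≤∑-fibers here (λ v → 2 ≤? timesTraversed γ v) (poTraversals γ) isShort
        (λ v 2≤ → ≤-reflexive (sym (EncounterSteps.oneShortExit (twoEncounter-steps (only v 2≤)))))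

      N≤shortEntries : numSelfIntersections γ ≤ ∑ (poTraversals γ) (λ t → isShort t * selfIntersection (next t))
      N≤shortEntries = ≤-trans
        (length-filter≤∑-fibers here (λ v → 2 ≤? timesTraversed γ v) (poTraversals γ) entersShort
          (λ v 2≤ → ≤-reflexive (sym (EncounterSteps.oneShortEntry (twoEncounter-steps (only v 2≤))))))
        (≤-reflexive (∑-inBond≡∑-outBond γ (λ x y → 𝟙[ y ≟ x +ₘ 1 ] * selfIntersection y)))

      winding≡2⇒shortExits+shortEntries≤shortSteps : ∀ p → winding p ≡ 2 →
        ∑ (poTraversals γ) (λ t → isShort t * selfIntersection (here t)) +
        ∑ (poTraversals γ) (λ t → isShort t * selfIntersection (next t)) ≤ ∑ (poTraversals γ) isShort
      winding≡2⇒shortExits+shortEntries≤shortSteps p w≡2 = begin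
        ∑ T (λ t → isShort t * selfIntersection (here t)) + ∑ T (λ t → isShort t * selfIntersection (next t))
          ≡⟨ ∑-+ T _ _ ⟨
        ∑ T (λ t → isShort t * selfIntersection (here t) + isShort t * selfIntersection (next t))
          ≤⟨ ∑-mono atMostOneEnd T ⟩
        ∑ T isShort
          ∎
        where
        open ≤-Reasoning
        T : List (Traversal n)
        T = poTraversals γ
        notAdjacent : ∀ b → 2 ≤ timesTraversed γ b → 2 ≤ timesTraversed γ (b +ₘ 1) → ⊥
        notAdjacent b 2≤b 2≤b+1 = 1+n≰n (begin
          3
            ≤⟨ +-mono-≤ 2≤b+1 (≤-reflexive (sym (EncounterSteps.oneLongExit (twoEncounter-steps (only b 2≤b))))) ⟩
          timesTraversed γ (b +ₘ 1) + ∑ (traversalsAt γ b) isLong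
            ≤⟨ timesTraversed+longExits≤winding b ⟩
          winding (b +ₘ 1)
            ≡⟨ trans (winding-constant (b +ₘ 1) p) w≡2 ⟩
          2 ∎)
        atMostOneEnd : ∀ t → isShort t * selfIntersection (here t) + isShort t * selfIntersection (next t) ≤ isShort t
        atMostOneEnd t with next t ≟ here t +ₘ 1
        ... | no  _     = z≤n
        ... | yes short = ≤-trans
          (≤-reflexive (cong₂ _+_ (*-identityˡ _) (trans (*-identityˡ _) (cong selfIntersection short))))
          (𝟙+𝟙≤1 (2 ≤? timesTraversed γ (here t)) (2 ≤? timesTraversed γ (here t +ₘ 1)) (notAdjacent (here t)))

n*C+2a≡3l⇒C≤2 : ∀ {n C a l} → 1 ≤ a → n * C + 2 * a ≡ 3 * l → l ≤ n → C ≤ 2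
n*C+2a≡3l⇒C≤2 {n} {C} {a} {l} 1≤a eq l≤n = ≮⇒≥ λ 2<C → <-irrefl refl (begin-strict
  n * 3           <⟨ m<m+n (n * 3) (≤-trans 1≤a (m≤m+n a (a + 0))) ⟩
  n * 3 + 2 * a   ≤⟨ +-monoˡ-≤ (2 * a) (*-monoʳ-≤ n 2<C) ⟩
  n * C + 2 * a   ≡⟨ eq ⟩
  3 * l           ≤⟨ *-monoʳ-≤ 3 l≤n ⟩
  3 * n           ≡⟨ *-comm 3 n ⟩
  n * 3           ∎)
  where open ≤-Reasoning

4N+2n≤3l : ∀ {N n a l} → N + N ≤ a → n * 2 + 2 * a ≡ 3 * l → 4 * N + 2 * n ≤ 3 * l
4N+2n≤3l {N} {n} {a} {l} 2N≤a eq = begin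
  4 * N + 2 * n       ≡⟨ rearrange N n ⟩
  n * 2 + 2 * (N + N) ≤⟨ +-monoʳ-≤ (n * 2) (*-monoʳ-≤ 2 2N≤a) ⟩
  n * 2 + 2 * a       ≡⟨ eq ⟩
  3 * l               ∎
  where
  open ≤-Reasoning
  rearrange : ∀ N n → 4 * N + 2 * n ≡ n * 2 + 2 * (N + N)
  rearrange = solve-∀

corollary1 : ∀ (n : ℕ) .{{_ : NonZero n}} → 3 < n →
    ∀ (γ : PseudoOrbit n) (l N : ℕ) →
    PrimitivePO γ → poLength γ ≡ l → 0 < l → l ≤ n →
    OnlyLength0TwoEncounters γ → numSelfIntersections γ ≡ N → 0 < N →
    -- N ≤ (3l-2n)/4 ≤ l/4 ≤ n/4, denominators cleared
    (4 * N + 2 * n ≤ 3 * l) × (3 * l ≤ l + 2 * n) × (l ≤ n)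
corollary1 n _ γ .(poLength γ) .(numSelfIntersections γ) _ refl _ l≤n only refl 0<N =
  4N+2n≤3l {numSelfIntersections γ} {n} {a} {poLength γ} 2N≤a
    (subst (λ C → n * C + 2 * a ≡ 3 * poLength γ) C≡2 (winding-equation γ v)) ,
  +-monoʳ-≤ (poLength γ) (*-monoʳ-≤ 2 l≤n) ,
  l≤n
  where
  a : ℕ
  a = ∑ (poTraversals γ) isShort
  someSelfIntersection : ∃[ v ] 2 ≤ timesTraversed γ v
  someSelfIntersection = 0<length-filter⇒∃ (λ u → 2 ≤? timesTraversed γ u) (allFin n) 0<N
  v : Fin n
  v = proj₁ someSelfIntersection
  2≤C : 2 ≤ winding γ v
  2≤C = ≤-trans (proj₂ someSelfIntersection) (timesTraversed≤winding γ v)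
  1≤a : 1 ≤ a
  1≤a = ≤-trans 0<N (≤-trans (N≤shortExits γ only)
          (∑-mono (λ t → *-𝟙≤ (isShort t) (2 ≤? timesTraversed γ (here t))) (poTraversals γ)))
  C≡2 : winding γ v ≡ 2
  C≡2 = ≤-antisym (n*C+2a≡3l⇒C≤2 1≤a (winding-equation γ v) l≤n) 2≤C
  2N≤a : numSelfIntersections γ + numSelfIntersections γ ≤ a
  2N≤a = ≤-trans (+-mono-≤ (N≤shortExits γ only) (N≤shortEntries γ only))
           (winding≡2⇒shortExits+shortEntries≤shortSteps γ only v C≡2)
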